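{- Let $p$ be a prime and $a$ a positive integer. Then $$\frac12\sum_{k=1}^{p^a-1}\binom{2k}{k}+\sum_{k=1}^{p^a-1}\binom{2k}{k+1}=\binom{2p^a-1}{p^a-1}-1\equiv p\,[p=2]+p^2\,[p=3]\pmod{p^3}.$$
   Context: For an assertion $A$, $[A]$ equals $1$ if $A$ holds and $0$ otherwise. For rational numbers $x,y$, $x\equiv y\pmod{p^m}$ means that $(x-y)/p^m$ is a rational number whose denominator is not divisible by $p$. -}

module Defs where

open import Data.Nat as ℕ using (ℕ; zero; suc; NonZero; _^_)
open import Data.Nat.Properties using (m^n≢0)
open import Data.Nat.Divisibility using (_∣_)
open import Data.Nat.Combinatorics using (_C_)
open import Data.Integer as ℤ using (ℤ; +_)
open import Data.Rational as ℚ using (ℚ; ↧ₙ_; _-_; _*_; _+_)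
open import Relation.Nullary using (¬_)

sum1to : ℕ → (ℕ → ℚ) → ℚ
sum1to zero    f = ℚ.0ℚ
sum1to (suc n) f = sum1to n f + f (suc n)

nℚ : ℕ → ℚ
nℚ n = (+ n) ℚ./ 1

iv : ℕ → ℕ → ℕ
iv p q with p ℕ.≟ q
... | Relation.Nullary.yes _ = 1
... | Relation.Nullary.no  _ = 0

-- x ≡ y (mod p^m) for rationals: (x - y)/p^m has denominator not divisible by p.
-- (Data.Rational is normalised, so ↧ₙ is the reduced denominator.)
_≡_[mod_^_] : ℚ → ℚ → (p : ℕ) → .{{NonZero p}} → ℕ → Set
(x ≡ y [mod p ^ m ]) = ¬ (p ∣ ↧ₙ ((x - y) * (ℚ._/_ (+ 1) (p ^ m) {{m^n≢0 p m}})))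

module Submission where

-- Write B q = C(2q-1, q-1), so that the right-hand side of the theorem is B (p^a) - 1.
-- The identity  Σ_{k<q} C(2k,k) + 2 Σ_{k<q} C(2k,k+1) + 2 = 2 B q  follows by induction
-- from Pascal's rule (CentralBinomialSum) and is moved into ℚ (RationalTransfer).
-- For the congruence  B (p^a) ≡ 1 + p [p = 2] + p² [p = 3]  (mod p³)  we pass from
-- q = p r to r.  Splitting (q+1)⋯(2q) = 2 B q · q! into factors prime to p and multiples
-- of p gives  B q · Y = B r · X  with  X = Π (q + j),  Y = Π j  over 1 ≤ j < q, p ∤ j
-- (PrimeSplitting).  Pairing j with q - j shows  X² ≡ Y² + 2q² Π′ (mod 4q⁴)  (Pairing),
-- whence X ≡ Y (mod p³) if p is odd and p² ∣ q, or if q = p ≥ 5, where p ∣ Π′ comes from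
-- Fermat's theorem and the vanishing of power sums modulo p (Wolstenholme); for p = 2,
-- X ≡ Y (mod q) suffices once 8 ∣ q.  Descending along powers of p (Lifting) leaves
-- B 2 = 3, B 4 = 35, B 3 = 10 and Wolstenholme's B p ≡ 1 (mod p³).

open import Data.Nat using (ℕ; suc)
import Data.Nat as ℕ
open import Data.Nat.Primality using (Prime)
open import Data.Nat.Divisibility using () renaming (_∣_ to _∣ℕ_)

module Iterated where
  open import Data.Nat using (ℕ; zero; suc; _+_; _∸_; _≤_; s≤s; z≤n)
  open import Data.Nat.Properties using (≤-refl; m≤n⇒m≤1+n; +-suc; +-identityʳ)
  open import Algebra.Bundles using (CommutativeMonoid)

  Forall₁ : ∀ {r} → ℕ → (ℕ → Set r) → Set r
  Forall₁ n P = ∀ j → 1 ≤ j → j ≤ n → P j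

  forall-init : ∀ {r n} {P : ℕ → Set r} → Forall₁ (suc n) P → Forall₁ n P
  forall-init h j 1≤j j≤n = h j 1≤j (m≤n⇒m≤1+n j≤n)

  forall-last : ∀ {r n} {P : ℕ → Set r} → Forall₁ (suc n) P → P (suc n)
  forall-last h = h _ (s≤s z≤n) ≤-refl

  module BigOperator {c ℓ} (M : CommutativeMonoid c ℓ) where
    open CommutativeMonoid M renaming (Carrier to A)
    open import Algebra.Properties.CommutativeSemigroup commutativeSemigroup
      using (interchange; xy∙z≈xz∙y)
    open import Relation.Binary.Reasoning.Setoid setoid

    ⨁ : ℕ → (ℕ → A) → A
    ⨁ zero    f = ε
    ⨁ (suc n) f = ⨁ n f ∙ f (suc n)

    ⨁-preserves : ∀ {r} (R : A → A → Set r) → R ε ε → (∀ {a b c d} → R a b → R c d → R (a ∙ c) (b ∙ d)) →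
                  ∀ n {f g} → Forall₁ n (λ j → R (f j) (g j)) → R (⨁ n f) (⨁ n g)
    ⨁-preserves R Rε R∙ zero    h = Rε
    ⨁-preserves R Rε R∙ (suc n) h = R∙ (⨁-preserves R Rε R∙ n (forall-init h)) (forall-last h)

    ⨁-closed : ∀ {r} (P : A → Set r) → P ε → (∀ {a b} → P a → P b → P (a ∙ b)) →
               ∀ n {f} → Forall₁ n (λ j → P (f j)) → P (⨁ n f)
    ⨁-closed P Pε P∙ n = ⨁-preserves (λ a _ → P a) Pε P∙ n {g = λ _ → ε}

    ⨁-cong : ∀ n {f g} → Forall₁ n (λ j → f j ≈ g j) → ⨁ n f ≈ ⨁ n g
    ⨁-cong = ⨁-preserves _≈_ refl ∙-cong

    ⨁-ε : ∀ n {f} → Forall₁ n (λ j → f j ≈ ε) → ⨁ n f ≈ ε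
    ⨁-ε = ⨁-closed (_≈ ε) refl (λ a≈ε b≈ε → trans (∙-cong a≈ε b≈ε) (identityˡ ε))

    ⨁-∙ : ∀ n f g → ⨁ n (λ j → f j ∙ g j) ≈ ⨁ n f ∙ ⨁ n g
    ⨁-∙ zero    f g = sym (identityˡ ε)
    ⨁-∙ (suc n) f g = begin
      ⨁ n (λ j → f j ∙ g j) ∙ (f (suc n) ∙ g (suc n)) ≈⟨ ∙-congʳ (⨁-∙ n f g) ⟩
      (⨁ n f ∙ ⨁ n g) ∙ (f (suc n) ∙ g (suc n))       ≈⟨ interchange _ _ _ _ ⟩
      ⨁ (suc n) f ∙ ⨁ (suc n) g                       ∎

    ⨁-front : ∀ n f → ⨁ (suc n) f ≈ f 1 ∙ ⨁ n (λ j → f (suc j))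
    ⨁-front zero    f = trans (identityˡ (f 1)) (sym (identityʳ (f 1)))
    ⨁-front (suc n) f = trans (∙-congʳ (⨁-front n f)) (assoc (f 1) _ _)

    ⨁-split : ∀ m n f → ⨁ (m + n) f ≈ ⨁ m f ∙ ⨁ n (λ t → f (m + t))
    ⨁-split m zero f rewrite +-identityʳ m = sym (identityʳ (⨁ m f))
    ⨁-split m (suc n) f rewrite +-suc m n =
      trans (∙-congʳ (⨁-split m n f)) (assoc (⨁ m f) _ _)

    ⨁-reverse : ∀ n f → ⨁ n f ≈ ⨁ n (λ j → f (suc n ∸ j))
    ⨁-reverse zero    f = refl
    ⨁-reverse (suc n) f = sym (begin
      ⨁ (suc n) (λ j → f (suc (suc n) ∸ j))    ≈⟨ ⨁-front n _ ⟩
      f (suc n) ∙ ⨁ n (λ j → f (suc n ∸ j))    ≈⟨ ∙-congˡ (sym (⨁-reverse n f)) ⟩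
      f (suc n) ∙ ⨁ n f                        ≈⟨ comm _ _ ⟩
      ⨁ (suc n) f                              ∎)

    ⨁-swap : ∀ n m (g : ℕ → ℕ → A) → ⨁ n (λ j → ⨁ m (λ i → g i j)) ≈ ⨁ m (λ i → ⨁ n (λ j → g i j))
    ⨁-swap zero    m g = sym (⨁-ε m (λ _ _ _ → refl))
    ⨁-swap (suc n) m g = trans (∙-congʳ (⨁-swap n m g)) (sym (⨁-∙ m _ _))

    ⨁-telescope : ∀ n f → ⨁ n (λ j → f (suc j)) ∙ f 1 ≈ ⨁ n f ∙ f (suc n)
    ⨁-telescope zero    f = trans (identityˡ (f 1)) (sym (identityˡ (f 1)))
    ⨁-telescope (suc n) f = trans (xy∙z≈xz∙y _ _ _) (∙-congʳ (⨁-telescope n f))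

module Arithmetic where
  open Iterated
  open import Data.Nat
  open import Data.Nat.Properties
  open import Data.Nat.Divisibility
  open import Data.Nat.Combinatorics
  open import Data.Nat.DivMod using (m/n*n≡m)
  open import Data.Nat.Primality
  open import Data.Nat.Tactic.RingSolver using (solve-∀)
  open import Relation.Binary.PropositionalEquality
  open import Data.Sum using (inj₁; inj₂)
  open import Data.Product using (∃; _,_)
  open import Data.Empty using (⊥-elim)
  open import Relation.Nullary using (¬_)

  open BigOperator +-0-commutativeMonoid public
    using () renaming (⨁ to Σ; ⨁-cong to Σ-cong; ⨁-∙ to Σ-+; ⨁-front to Σ-front;
                       ⨁-swap to Σ-swap; ⨁-telescope to Σ-telescope; ⨁-closed to Σ-closed)
  open BigOperator *-1-commutativeMonoid public
    using () renaming (⨁ to Π; ⨁-cong to Π-cong; ⨁-∙ to Π-*; ⨁-split to Π-split; ⨁-ε to Π-ones)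

  Σ-*ˡ : ∀ n c f → Σ n (λ j → c * f j) ≡ c * Σ n f
  Σ-*ˡ zero    c f = sym (*-zeroʳ c)
  Σ-*ˡ (suc n) c f = trans (cong (_+ c * f (suc n)) (Σ-*ˡ n c f)) (sym (*-distribˡ-+ c _ _))

  Σ-ones : ∀ n → Σ n (λ _ → 1) ≡ n
  Σ-ones zero    = refl
  Σ-ones (suc n) = trans (cong (_+ 1) (Σ-ones n)) (+-comm n 1)

  Σ-∣ : ∀ {d} n {f} → Forall₁ n (λ j → d ∣ f j) → d ∣ Σ n f
  Σ-∣ {d} = Σ-closed (d ∣_) (d ∣0) ∣m∣n⇒∣m+n

  binomial : ∀ m x → suc x ^ m ≡ 1 + Σ m (λ i → (m C i) * x ^ i)
  binomial zero    x = refl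
  binomial (suc m) x = begin
    suc x * suc x ^ m                                    ≡⟨ cong (suc x *_) (binomial m x) ⟩
    suc x * (1 + T)                                      ≡⟨ expand x T ⟩
    1 + ((x + x * T) + T)                                ≡⟨ cong (1 +_) (cong₂ _+_ (sym shifted) (sym unshifted)) ⟩
    1 + (Σ (suc m) (λ i → (m C pred i) * x ^ i) + Σ (suc m) (λ i → (m C i) * x ^ i))
                                                         ≡⟨ cong (1 +_) (sym (Σ-+ (suc m) _ _)) ⟩
    1 + Σ (suc m) (λ i → (m C pred i) * x ^ i + (m C i) * x ^ i)
                                                         ≡⟨ cong (1 +_) (Σ-cong (suc m) pascal) ⟩
    1 + Σ (suc m) (λ i → (suc m C i) * x ^ i)            ∎
    where
    open ≡-Reasoning
    T = Σ m (λ i → (m C i) * x ^ i)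
    expand : ∀ x T → suc x * (1 + T) ≡ 1 + ((x + x * T) + T)
    expand = solve-∀
    pascal : Forall₁ (suc m) (λ i → (m C pred i) * x ^ i + (m C i) * x ^ i ≡ (suc m C i) * x ^ i)
    pascal (suc i) _ _ = trans (sym (*-distribʳ-+ (x ^ suc i) (m C i) (m C suc i)))
                               (cong (_* x ^ suc i) (nCk+nC[k+1]≡[n+1]C[k+1] m i))
    shifted : Σ (suc m) (λ i → (m C pred i) * x ^ i) ≡ x + x * T
    shifted = begin
      Σ (suc m) (λ i → (m C pred i) * x ^ i)       ≡⟨ Σ-front m _ ⟩
      1 * (x * 1) + Σ m (λ j → (m C j) * (x * x ^ j))
        ≡⟨ cong₂ _+_ (trans (*-identityˡ (x * 1)) (*-identityʳ x)) (Σ-cong m (λ j _ _ → x*[y*z]≡y*[x*z] (m C j) x (x ^ j))) ⟩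
      x + Σ m (λ j → x * ((m C j) * x ^ j))        ≡⟨ cong (x +_) (Σ-*ˡ m x _) ⟩
      x + x * T                                    ∎
      where
      x*[y*z]≡y*[x*z] : ∀ a b c → a * (b * c) ≡ b * (a * c)
      x*[y*z]≡y*[x*z] = solve-∀
    unshifted : Σ (suc m) (λ i → (m C i) * x ^ i) ≡ T
    unshifted = trans (cong (λ c → T + c * x ^ suc m) (k>n⇒nCk≡0 (n<1+n m))) (+-identityʳ T)

  cube : ∀ p → p * p * p ≡ p ^ 3
  cube p = trans (*-assoc p p p) (cong (λ z → p * (p * z)) (sym (*-identityʳ p)))

  prime>1 : ∀ {p} → Prime p → 1 < p
  prime>1 {p} pp = nonTrivial⇒n>1 p {{prime⇒nonTrivial pp}}

  prime∤1 : ∀ {p} → Prime p → ¬ (p ∣ 1)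
  prime∤1 pp p∣1 = <⇒≢ (prime>1 pp) (sym (∣1⇒≡1 p∣1))

  ∤-below : ∀ {p k} → 0 < k → k < p → ¬ (p ∣ k)
  ∤-below {k = suc k} _ k<p p∣k = <⇒≱ k<p (∣⇒≤ p∣k)

  prime∤! : ∀ {p} → Prime p → ∀ m → m < p → ¬ (p ∣ m !)
  prime∤! pp zero    _   = prime∤1 pp
  prime∤! pp (suc m) m<p p∣m! with euclidsLemma (suc m) (m !) pp p∣m!
  ... | inj₁ p∣m = ∤-below (s≤s z≤n) m<p p∣m
  ... | inj₂ p∣m! = prime∤! pp m (<⇒≤ m<p) p∣m!

  C-factorials : ∀ {n k} → k ≤ n → (n C k) * (k ! * (n ∸ k) !) ≡ n !
  C-factorials {n} {k} k≤n = trans (cong (_* (k ! * (n ∸ k) !)) (nCk≡n!/k![n-k]! k≤n)) (m/n*n≡m (k![n∸k]!∣n! k≤n))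
    where instance _ = m*n≢0 (k !) ((n ∸ k) !) {{k !≢0}} {{(n ∸ k) !≢0}}

  -- p divides C(p,i) for 0 < i < p, since p ∣ p! = C(p,i) i! (p-i)! and p ∤ i! (p-i)!.
  prime∣C : ∀ {p} → Prime p → ∀ i → 0 < i → i < p → p ∣ p C i
  prime∣C {p} pp i 0<i i<p with euclidsLemma _ _ pp p∣C*i!*[p-i]!
    where
    p∣p! : ∀ q → 0 < q → q ∣ q !
    p∣p! (suc q) _ = m∣m*n (q !)
    p∣C*i!*[p-i]! : p ∣ (p C i) * (i ! * (p ∸ i) !)
    p∣C*i!*[p-i]! = subst (p ∣_) (sym (C-factorials (<⇒≤ i<p))) (p∣p! p (<-trans 0<i i<p))
  ... | inj₁ p∣C = p∣C
  ... | inj₂ p∣i!*[p-i]! with euclidsLemma _ _ pp p∣i!*[p-i]!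
  ...   | inj₁ p∣i! = ⊥-elim (prime∤! pp i i<p p∣i!)
  ...   | inj₂ p∣[p-i]! = ⊥-elim (prime∤! pp (p ∸ i) (∸-monoʳ-< 0<i (<⇒≤ i<p)) p∣[p-i]!)

  fermat : ∀ {p} → Prime p → ∀ k → ∃ λ t → k ^ p ≡ k + t * p
  fermat {zero}  pp = ⊥-elim (¬prime[0] pp)
  fermat {suc n} pp zero    = 0 , refl
  fermat {suc n} pp (suc k) with fermat pp k
                               | Σ-∣ n (λ i 0<i i≤n → ∣m⇒∣m*n (k ^ i) (prime∣C pp i 0<i (s≤s i≤n)))
  ... | t , k^p≡ | divides u middle≡ = u + t , (begin
    suc k ^ suc n                                               ≡⟨ binomial (suc n) k ⟩
    1 + (Σ n (λ i → (suc n C i) * k ^ i) + (suc n C suc n) * k ^ suc n)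
                                    ≡⟨ cong₂ (λ a b → 1 + (a + b * k ^ suc n)) middle≡ (nCn≡1 (suc n)) ⟩
    1 + (u * suc n + 1 * k ^ suc n)                             ≡⟨ cong (λ a → 1 + (u * suc n + 1 * a)) k^p≡ ⟩
    1 + (u * suc n + 1 * (k + t * suc n))                       ≡⟨ collect u (suc n) k t ⟩
    suc k + (u + t) * suc n                                     ∎)
    where
    open ≡-Reasoning
    collect : ∀ u p k t → 1 + (u * p + 1 * (k + t * p)) ≡ suc k + (u + t) * p
    collect = solve-∀

  fermat-unit : ∀ {p} → Prime p → ∀ k → ¬ (p ∣ k) → p ∣ k ^ (p ∸ 1) ∸ 1
  fermat-unit {zero}  pp = ⊥-elim (¬prime[0] pp)
  fermat-unit {suc n} pp zero    p∤0 = ⊥-elim (p∤0 (_ ∣0))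
  fermat-unit {suc n} pp (suc k) p∤k with fermat pp (suc k)
  ... | t , k^p≡ with euclidsLemma (suc k) (suc k ^ n ∸ 1) pp (divides t k*[k^n-1]≡)
    where
    k*[k^n-1]≡ : suc k * (suc k ^ n ∸ 1) ≡ t * suc n
    k*[k^n-1]≡ = begin
      suc k * (suc k ^ n ∸ 1)            ≡⟨ *-distribˡ-∸ (suc k) (suc k ^ n) 1 ⟩
      suc k ^ suc n ∸ suc k * 1          ≡⟨ cong₂ _∸_ k^p≡ (*-identityʳ (suc k)) ⟩
      suc k + t * suc n ∸ suc k          ≡⟨ m+n∸m≡n (suc k) (t * suc n) ⟩
      t * suc n                          ∎
      where open ≡-Reasoning
  ... | inj₁ p∣k = ⊥-elim (p∤k p∣k)
  ... | inj₂ p∣k^n-1 = p∣k^n-1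

  S : ℕ → ℕ → ℕ
  S n e = Σ n (λ j → j ^ e)

  -- Expanding Σ_j (j+1)^(m+1) binomially and telescoping:
  --   (n+1) + Σ_{i=1}^{m} C(m+1,i) S n i = (n+1)^(m+1).
  powerSum-identity : ∀ n m → suc n + Σ m (λ i → (suc m C i) * S n i) ≡ suc n ^ suc m
  powerSum-identity n m = +-cancelˡ-≡ (S n (suc m)) _ _ (begin
    S n (suc m) + (suc n + X)                             ≡⟨ sym (rearrange n X (S n (suc m))) ⟩
    (n + (X + 1 * S n (suc m))) + 1                       ≡⟨ cong (_+ 1) (sym expanded) ⟩
    Σ n (λ j → suc j ^ suc m) + 1                          ≡⟨ cong (Σ n (λ j → suc j ^ suc m) +_) (sym (^-zeroˡ (suc m))) ⟩
    Σ n (λ j → suc j ^ suc m) + 1 ^ suc m                  ≡⟨ Σ-telescope n (λ j → j ^ suc m) ⟩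
    S n (suc m) + suc n ^ suc m                           ∎)
    where
    open ≡-Reasoning
    X = Σ m (λ i → (suc m C i) * S n i)
    rearrange : ∀ n X S → (n + (X + 1 * S)) + 1 ≡ S + (suc n + X)
    rearrange = solve-∀
    expanded : Σ n (λ j → suc j ^ suc m) ≡ n + (X + 1 * S n (suc m))
    expanded = begin
      Σ n (λ j → suc j ^ suc m)
        ≡⟨ Σ-cong n (λ j _ _ → binomial (suc m) j) ⟩
      Σ n (λ j → 1 + Σ (suc m) (λ i → (suc m C i) * j ^ i))
        ≡⟨ Σ-+ n (λ _ → 1) _ ⟩
      Σ n (λ _ → 1) + Σ n (λ j → Σ (suc m) (λ i → (suc m C i) * j ^ i))
        ≡⟨ cong₂ _+_ (Σ-ones n) (Σ-swap n (suc m) (λ i j → (suc m C i) * j ^ i)) ⟩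
      n + Σ (suc m) (λ i → Σ n (λ j → (suc m C i) * j ^ i))
        ≡⟨ cong (n +_) (Σ-cong (suc m) (λ i _ _ → Σ-*ˡ n (suc m C i) (λ j → j ^ i))) ⟩
      n + (X + (suc m C suc m) * S n (suc m))
        ≡⟨ cong (λ c → n + (X + c * S n (suc m))) (nCn≡1 (suc m)) ⟩
      n + (X + 1 * S n (suc m))
        ∎

  -- For a prime p = n + 1, p divides S n e whenever 1 ≤ e < p - 1: by induction on e,
  -- the identity above leaves  p ∣ C(e+1,e) S n e = (e+1) S n e  with  p ∤ e + 1.
  powerSum-∣ : ∀ {n} → Prime (suc n) → ∀ m → m < n → Forall₁ m (λ e → suc n ∣ S n e)
  powerSum-∣ pp zero    _   e 1≤e e≤0 = ⊥-elim (<⇒≱ 1≤e e≤0)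
  powerSum-∣ pp (suc m) m+1<n e 1≤e e≤m+1 with m≤n⇒m<n∨m≡n e≤m+1
  ... | inj₁ (s≤s e≤m) = powerSum-∣ pp m (<⇒≤ m+1<n) e 1≤e e≤m
  powerSum-∣ {n} pp (suc m) m+1<n _ _ _ | inj₂ refl
      with euclidsLemma (suc (suc m)) (S n (suc m)) pp p∣[m+2]*S
    where
    p = suc n
    earlier : p ∣ Σ m (λ i → (suc (suc m) C i) * S n i)
    earlier = Σ-∣ m (λ i 1≤i i≤m → ∣n⇒∣m*n (suc (suc m) C i) (powerSum-∣ pp m (<⇒≤ m+1<n) i 1≤i i≤m))
    whole : p ∣ p + (Σ m (λ i → (suc (suc m) C i) * S n i) + (suc (suc m) C suc m) * S n (suc m))
    whole = subst (p ∣_) (sym (powerSum-identity n (suc m))) (m∣m*n (p ^ suc m))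
    C[m+2,m+1]≡m+2 : suc (suc m) C suc m ≡ suc (suc m)
    C[m+2,m+1]≡m+2 = trans (nCk≡nC[n∸k] (n≤1+n (suc m)))
                           (trans (cong (suc (suc m) C_) (m+n∸n≡m 1 (suc m))) (nC1≡n (suc (suc m))))
    p∣[m+2]*S : p ∣ suc (suc m) * S n (suc m)
    p∣[m+2]*S = subst (λ c → p ∣ c * S n (suc m)) C[m+2,m+1]≡m+2
                      (∣m+n∣m⇒∣n (∣m+n∣m⇒∣n whole ∣-refl) earlier)
  ... | inj₁ p∣m+2 = ⊥-elim (∤-below (s≤s z≤n) (s≤s m+1<n) p∣m+2)
  ... | inj₂ p∣S = p∣S

module IntCongruence where
  import Data.Nat as ℕ
  import Data.Nat.Properties as ℕ
  import Data.Nat.Divisibility as ℕ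
  open import Data.Nat using (ℕ; zero; suc)
  open import Data.Nat.Primality using (Prime; euclidsLemma; prime⇒nonZero)
  open import Data.Integer using (ℤ; +_; -_; _+_; _-_; _*_; 0ℤ) renaming (∣_∣ to abs)
  open import Data.Integer.Properties
  open import Data.Integer.Divisibility.Signed
  open import Data.Integer.Tactic.RingSolver using (solve-∀)
  open import Relation.Binary.PropositionalEquality
  open import Data.Sum using (_⊎_; inj₁; inj₂)
  open import Data.Empty using (⊥-elim)
  open import Relation.Nullary using (¬_)
  open import Algebra.Properties.CommutativeSemigroup ℕ.*-commutativeSemigroup using (x∙yz≈z∙xy)

  record _≡_⟨mod_⟩ (a b m : ℤ) : Set where
    constructor mod-intro
    field m∣a-b : m ∣ (a - b)
  open _≡_⟨mod_⟩ public

  infix 4 _≡_⟨mod_⟩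

  ≡⇒≡-mod : ∀ {m a b} → a ≡ b → a ≡ b ⟨mod m ⟩
  ≡⇒≡-mod {m} {a} refl = mod-intro (divides 0ℤ (trans (+-inverseʳ a) (sym (*-zeroˡ m))))

  mod-refl : ∀ {m a} → a ≡ a ⟨mod m ⟩
  mod-refl = ≡⇒≡-mod refl

  mod-sym : ∀ {m a b} → a ≡ b ⟨mod m ⟩ → b ≡ a ⟨mod m ⟩
  mod-sym {m} {a} {b} (mod-intro h) = mod-intro (subst (m ∣_) (neg-diff a b) (∣m⇒∣-m h))
    where
    neg-diff : ∀ a b → - (a - b) ≡ b - a
    neg-diff = solve-∀

  mod-trans : ∀ {m a b c} → a ≡ b ⟨mod m ⟩ → b ≡ c ⟨mod m ⟩ → a ≡ c ⟨mod m ⟩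
  mod-trans {m} {a} {b} {c} (mod-intro h₁) (mod-intro h₂) =
    mod-intro (subst (m ∣_) (chain a b c) (∣m∣n⇒∣m+n h₁ h₂))
    where
    chain : ∀ a b c → (a - b) + (b - c) ≡ a - c
    chain = solve-∀

  mod-+ : ∀ {m a b c d} → a ≡ b ⟨mod m ⟩ → c ≡ d ⟨mod m ⟩ → a + c ≡ b + d ⟨mod m ⟩
  mod-+ {m} {a} {b} {c} {d} (mod-intro h₁) (mod-intro h₂) =
    mod-intro (subst (m ∣_) (sum-diff a b c d) (∣m∣n⇒∣m+n h₁ h₂))
    where
    sum-diff : ∀ a b c d → (a - b) + (c - d) ≡ (a + c) - (b + d)
    sum-diff = solve-∀

  mod-* : ∀ {m a b c d} → a ≡ b ⟨mod m ⟩ → c ≡ d ⟨mod m ⟩ → a * c ≡ b * d ⟨mod m ⟩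
  mod-* {m} {a} {b} {c} {d} (mod-intro h₁) (mod-intro h₂) =
    mod-intro (subst (m ∣_) (product-diff a b c d) (∣m∣n⇒∣m+n (∣n⇒∣m*n a h₂) (∣m⇒∣m*n d h₁)))
    where
    product-diff : ∀ a b c d → a * (c - d) + (a - b) * d ≡ a * c - b * d
    product-diff = solve-∀

  mod-weaken : ∀ {d m a b} → d ∣ m → a ≡ b ⟨mod m ⟩ → a ≡ b ⟨mod d ⟩
  mod-weaken d∣m (mod-intro m∣a-b) = mod-intro (∣-trans d∣m m∣a-b)

  mod-0 : ∀ {m a} → m ∣ a → a ≡ 0ℤ ⟨mod m ⟩
  mod-0 {m} {a} m∣a = mod-intro (subst (m ∣_) (sym (+-identityʳ a)) m∣a)

  mod-multiple : ∀ {m} a t → a + t * m ≡ a ⟨mod m ⟩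
  mod-multiple {m} a t = mod-intro (divides t (cancel a t m))
    where
    cancel : ∀ a t m → a + t * m - a ≡ t * m
    cancel = solve-∀

  mod-∣ : ∀ {m a b} → a ≡ b ⟨mod m ⟩ → m ∣ a → m ∣ b
  mod-∣ {m} {a} {b} (mod-intro m∣a-b) m∣a = subst (m ∣_) (cancel a b) (∣m∣n⇒∣m+n (∣m⇒∣-m m∣a-b) m∣a)
    where
    cancel : ∀ a b → - (a - b) + a ≡ b
    cancel = solve-∀

  ∣-* : ∀ {a b x y} → + a ∣ x → + b ∣ y → + (a ℕ.* b) ∣ x * y
  ∣-* {x = x} {y} a∣x b∣y = ∣ᵤ⇒∣ (subst (_ ℕ.∣_) (sym (abs-* x y)) (ℕ.*-pres-∣ (∣⇒∣ᵤ a∣x) (∣⇒∣ᵤ b∣y)))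

  euclidsLemmaℤ : ∀ {p} → Prime p → ∀ a b → + p ∣ a * b → + p ∣ a ⊎ + p ∣ b
  euclidsLemmaℤ pp a b p∣ab with euclidsLemma (abs a) (abs b) pp (subst (_ ℕ.∣_) (abs-* a b) (∣⇒∣ᵤ p∣ab))
  ... | inj₁ p∣a = inj₁ (∣ᵤ⇒∣ p∣a)
  ... | inj₂ p∣b = inj₂ (∣ᵤ⇒∣ p∣b)

  primePower-cancelℕ : ∀ {p g} → Prime p → ¬ (p ℕ.∣ g) → ∀ k x → p ℕ.^ k ℕ.∣ g ℕ.* x → p ℕ.^ k ℕ.∣ x
  primePower-cancelℕ pp p∤g zero x _ = ℕ.1∣ x
  primePower-cancelℕ {p} {g} pp p∤g (suc k) x p^[k+1]∣gx
    with euclidsLemma g x pp (ℕ.∣-trans (ℕ.m∣m*n (p ℕ.^ k)) p^[k+1]∣gx)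
  ... | inj₁ p∣g = ⊥-elim (p∤g p∣g)
  ... | inj₂ (ℕ.divides x′ refl) =
    subst (p ℕ.* p ℕ.^ k ℕ.∣_) (ℕ.*-comm p x′)
          (ℕ.*-monoʳ-∣ p (primePower-cancelℕ pp p∤g k x′ (ℕ.*-cancelˡ-∣ p p^[k+1]∣p[gx′])))
    where
    instance _ = prime⇒nonZero pp
    p^[k+1]∣p[gx′] : p ℕ.* p ℕ.^ k ℕ.∣ p ℕ.* (g ℕ.* x′)
    p^[k+1]∣p[gx′] = subst (p ℕ.* p ℕ.^ k ℕ.∣_) (x∙yz≈z∙xy g x′ p) p^[k+1]∣gx

  primePower-cancel : ∀ {p} → Prime p → ∀ k g x → ¬ (+ p ∣ g) → + (p ℕ.^ k) ∣ g * x → + (p ℕ.^ k) ∣ x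
  primePower-cancel pp k g x p∤g p^k∣gx =
    ∣ᵤ⇒∣ (primePower-cancelℕ pp (λ p∣g → p∤g (∣ᵤ⇒∣ p∣g)) k (abs x)
                             (subst (_ ℕ.∣_) (abs-* g x) (∣⇒∣ᵤ p^k∣gx)))

  mod-cancel : ∀ {p} → Prime p → ∀ k g {a b} → ¬ (+ p ∣ g) →
               g * a ≡ g * b ⟨mod + (p ℕ.^ k) ⟩ → a ≡ b ⟨mod + (p ℕ.^ k) ⟩
  mod-cancel pp k g {a} {b} p∤g (mod-intro h) =
    mod-intro (primePower-cancel pp k g (a - b) p∤g (subst (_ ∣_) (factor g a b) h))
    where
    factor : ∀ g a b → g * a - g * b ≡ g * (a - b)
    factor = solve-∀

  mod-square-root : ∀ {p} → Prime p → ∀ k X Y → ¬ (+ p ∣ X + Y) →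
                    X * X ≡ Y * Y ⟨mod + (p ℕ.^ k) ⟩ → X ≡ Y ⟨mod + (p ℕ.^ k) ⟩
  mod-square-root pp k X Y p∤X+Y (mod-intro h) =
    mod-intro (primePower-cancel pp k (X + Y) (X - Y) p∤X+Y (subst (_ ∣_) (difference-of-squares X Y) h))
    where
    difference-of-squares : ∀ X Y → X * X - Y * Y ≡ (X + Y) * (X - Y)
    difference-of-squares = solve-∀

module IntProducts where
  open Iterated
  import Data.Nat as ℕ
  import Data.Nat.Properties as ℕ
  open import Data.Nat using (ℕ; zero; suc)
  open import Data.Nat.Primality using (Prime)
  open import Data.Integer using (ℤ; +_; -_; _+_; _*_; 0ℤ; 1ℤ)
  open import Data.Integer.Properties
  open import Data.Integer.Divisibility.Signed using (_∣_; ∣⇒∣ᵤ)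
  open import Data.Integer.Tactic.RingSolver using (solve-∀)
  open import Relation.Binary.PropositionalEquality
  open import Data.Sum using (inj₁; inj₂)
  open import Relation.Nullary using (¬_)
  open import Function using (_∘_)
  open IntCongruence

  open BigOperator Data.Integer.Properties.+-0-commutativeMonoid public
    using () renaming (⨁ to Σℤ)
  open BigOperator Data.Integer.Properties.*-1-commutativeMonoid public
    using () renaming (⨁ to Πℤ; ⨁-cong to Πℤ-cong; ⨁-∙ to Πℤ-*; ⨁-reverse to Πℤ-reverse;
                       ⨁-preserves to Πℤ-preserves; ⨁-closed to Πℤ-closed)
  open Arithmetic using (Σ; Π; prime∤1)

  Π-cast : ∀ n f → + Π n f ≡ Πℤ n (+_ ∘ f)
  Π-cast zero    f = refl
  Π-cast (suc n) f = trans (pos-* (Π n f) (f (suc n))) (cong (_* + f (suc n)) (Π-cast n f))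

  Πℤ-mod : ∀ {m} n {f g} → Forall₁ n (λ j → f j ≡ g j ⟨mod m ⟩) → Πℤ n f ≡ Πℤ n g ⟨mod m ⟩
  Πℤ-mod {m} = Πℤ-preserves (_≡_⟨mod m ⟩) mod-refl mod-*

  Πℤ-∤ : ∀ {p} → Prime p → ∀ n {f} → Forall₁ n (λ j → ¬ (+ p ∣ f j)) → ¬ (+ p ∣ Πℤ n f)
  Πℤ-∤ {p} pp = Πℤ-closed (λ a → ¬ (+ p ∣ a)) (λ p∣1 → prime∤1 pp (∣⇒∣ᵤ p∣1)) ∤-*
    where
    ∤-* : ∀ {a b} → ¬ (+ p ∣ a) → ¬ (+ p ∣ b) → ¬ (+ p ∣ a * b)
    ∤-* {a} {b} p∤a p∤b p∣ab with euclidsLemmaℤ pp a b p∣ab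
    ... | inj₁ p∣a = p∤a p∣a
    ... | inj₂ p∣b = p∤b p∣b

  Σℤ-neg : ∀ n f → Σℤ n (λ j → - + f j) ≡ - + Σ n f
  Σℤ-neg zero    f = refl
  Σℤ-neg (suc n) f = trans (cong (_+ - + f (suc n)) (Σℤ-neg n f))
    (trans (sym (neg-distrib-+ (+ Σ n f) (+ f (suc n)))) (cong -_ (sym (pos-+ (Σ n f) (f (suc n))))))

  -- First-order expansion of  Π_j (w j + ε e j):  modulo ε² it equals
  -- Π w + ε Π′ n, where Π′ is the derivative  Σ_j (Π_{i≠j} w i) e j.
  module FirstOrder (ε : ℤ) (w e : ℕ → ℤ) where
    Π′ : ℕ → ℤ
    Π′ zero    = 0ℤ
    Π′ (suc n) = Π′ n * w (suc n) + Πℤ n w * e (suc n)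

    expansion : ∀ n → Πℤ n (λ j → w j + ε * e j) ≡ Πℤ n w + ε * Π′ n ⟨mod ε * ε ⟩
    expansion zero    = ≡⇒≡-mod (sym (trans (cong (λ z → 1ℤ + z) (*-zeroʳ ε)) (+-identityʳ 1ℤ)))
    expansion (suc n) = mod-trans (mod-* (expansion n) (mod-refl {a = w (suc n) + ε * e (suc n)}))
      (subst (λ z → z ≡ Πℤ (suc n) w + ε * Π′ (suc n) ⟨mod ε * ε ⟩)
             (sym (multiply-out (Πℤ n w) (Π′ n) (w (suc n)) (e (suc n)) ε))
             (mod-multiple _ (Π′ n * e (suc n))))
      where
      multiply-out : ∀ A B w e ε → (A + ε * B) * (w + ε * e) ≡ (A * w + ε * (B * w + A * e)) + (B * e) * (ε * ε)
      multiply-out = solve-∀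

    -- If w j y j ≡ e j then  Π′ n ≡ (Π w) (Σ y),  i.e. Π′ is a logarithmic derivative.
    derivative-mod : ∀ {d} n y → Forall₁ n (λ j → w j * y j ≡ e j ⟨mod d ⟩) →
                     Π′ n ≡ Πℤ n w * Σℤ n y ⟨mod d ⟩
    derivative-mod zero    y h = ≡⇒≡-mod (sym (*-zeroʳ 1ℤ))
    derivative-mod (suc n) y h =
      mod-trans (mod-+ (mod-* (derivative-mod n y (forall-init h)) (mod-refl {a = w (suc n)}))
                       (mod-* (mod-refl {a = Πℤ n w}) (mod-sym (forall-last h))))
                (≡⇒≡-mod (collect (Πℤ n w) (Σℤ n y) (w (suc n)) (y (suc n))))
      where
      collect : ∀ A S w y → A * S * w + A * (w * y) ≡ A * w * (S + y)
      collect = solve-∀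

module CentralBinomial where
  open import Data.Nat
  open import Data.Nat.Properties
  open import Data.Nat.Combinatorics
  open import Data.Nat.Tactic.RingSolver using (solve-∀)
  open import Relation.Binary.PropositionalEquality
  open Arithmetic using (Π; C-factorials)

  rising : ℕ → ℕ → ℕ
  rising c n = Π n (λ j → c + j)

  factorial-rising : ∀ c n → (c + n) ! ≡ c ! * rising c n
  factorial-rising c zero    rewrite +-identityʳ c = sym (*-identityʳ (c !))
  factorial-rising c (suc n) rewrite +-suc c n = begin
    suc (c + n) * (c + n) !          ≡⟨ cong (suc (c + n) *_) (factorial-rising c n) ⟩
    suc (c + n) * (c ! * rising c n) ≡⟨ reorder (c + n) (c !) (rising c n) ⟩
    c ! * (rising c n * suc (c + n)) ∎
    where
    open ≡-Reasoning
    reorder : ∀ k a b → suc k * (a * b) ≡ a * (b * suc k)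
    reorder = solve-∀

  rising-0 : ∀ n → rising 0 n ≡ n !
  rising-0 n = sym (trans (factorial-rising 0 n) (+-identityʳ (rising 0 n)))

  B : ℕ → ℕ
  B q = (2 * q ∸ 1) C (q ∸ 1)

  -- 2q - 1 for q = N + 1, in the form produced by pattern matching.
  2[N+1]∸1 : ∀ N → 2 * suc N ∸ 1 ≡ suc (N + N)
  2[N+1]∸1 N = cong (_∸ 1) (double N)
    where
    double : ∀ N → 2 * suc N ≡ suc (suc (N + N))
    double = solve-∀

  -- 2 B q · q! = (2q)!/q!,  i.e.  2 B q · rising 0 q = rising q q  for q ≥ 1.
  B-rising : ∀ q → 1 ≤ q → B q * 2 * rising 0 q ≡ rising q q
  B-rising (suc N) _ = *-cancelʳ-≡ _ _ (q !) {{q !≢0}} (begin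
    B q * 2 * rising 0 q * q !              ≡⟨ cong (λ z → B q * 2 * z * q !) (rising-0 q) ⟩
    B q * 2 * (q * N !) * (q * N !)         ≡⟨ reorder (B q) (N !) N ⟩
    (q + q) * (B q * (N ! * (q * N !)))     ≡⟨ cong (λ z → (q + q) * (z * (N ! * q !))) B≡C ⟩
    (q + q) * ((m C N) * (N ! * q !))       ≡⟨ cong (λ z → (q + q) * ((m C N) * (N ! * z !))) (sym m∸N≡q) ⟩
    (q + q) * ((m C N) * (N ! * (m ∸ N) !)) ≡⟨ cong ((q + q) *_) (C-factorials (m≤n⇒m≤1+n (m≤m+n N N))) ⟩
    (q + q) * m !                          ≡⟨ cong (λ z → (q + q) * z !) (+-suc N N) ⟨
    (q + q) !                              ≡⟨ factorial-rising q q ⟩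
    q ! * rising q q                       ≡⟨ *-comm (q !) (rising q q) ⟩
    rising q q * q !                       ∎)
    where
    open ≡-Reasoning
    q = suc N
    m = suc (N + N)
    B≡C : B q ≡ m C N
    B≡C = cong (_C N) (2[N+1]∸1 N)
    m∸N≡q : m ∸ N ≡ q
    m∸N≡q = m+n∸n≡m q N
    reorder : ∀ b a N → b * 2 * (suc N * a) * (suc N * a) ≡ (suc N + suc N) * (b * (a * (suc N * a)))
    reorder = solve-∀

module PrimeSplitting (p : ℕ) (pp : Prime p) where
  open import Data.Nat
  open import Data.Nat.Properties
  open import Data.Nat.Divisibility
  open import Data.Nat.Primality
  open import Data.Nat.Tactic.RingSolver using (solve-∀)
  open import Data.Bool using (if_then_else_)
  open import Relation.Binary.PropositionalEquality
  open import Relation.Nullary using (¬_; does; yes; no)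
  open import Relation.Nullary.Decidable using (dec-true; dec-false)
  open Arithmetic using (Π; Π-cong; Π-*; Π-split; Π-ones; prime>1; ∤-below)
  open CentralBinomial

  instance _ = prime⇒nonZero pp

  ifDiv : ℕ → ℕ → ℕ → ℕ
  ifDiv j a b = if does (p ∣? j) then a else b

  ifDiv-∣ : ∀ {j} a b → p ∣ j → ifDiv j a b ≡ a
  ifDiv-∣ {j} a b p∣j = cong (if_then a else b) (dec-true (p ∣? j) p∣j)

  ifDiv-∤ : ∀ {j} a b → ¬ (p ∣ j) → ifDiv j a b ≡ b
  ifDiv-∤ {j} a b p∤j = cong (if_then a else b) (dec-false (p ∣? j) p∤j)

  unitFactor pFactor : ℕ → ℕ → ℕ
  unitFactor c j = ifDiv j 1 (c + j)
  pFactor    c j = ifDiv j (c + j) 1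

  unitPart pPart : ℕ → ℕ → ℕ
  unitPart c n = Π n (unitFactor c)
  pPart    c n = Π n (pFactor c)

  rising-split : ∀ c n → rising c n ≡ unitPart c n * pPart c n
  rising-split c n = trans (Π-cong n (λ j _ _ → sym (factors j))) (Π-* n (unitFactor c) (pFactor c))
    where
    factors : ∀ j → unitFactor c j * pFactor c j ≡ c + j
    factors j with p ∣? j
    ... | yes _ = +-identityʳ (c + j)
    ... | no  _ = *-identityʳ (c + j)

  p≡1+[p-1] : p ≡ suc (pred p)
  p≡1+[p-1] = sym (suc-pred p)

  -- Among  p r + 1, …, p r + p  only the last is a multiple of p.
  pPart-block : ∀ c r → Π p (λ t → pFactor c (p * r + t)) ≡ c + (p * r + p)
  pPart-block c r = begin
    Π p g                            ≡⟨ cong (λ z → Π z g) p≡1+[p-1] ⟩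
    Π (pred p) g * g (suc (pred p))  ≡⟨ cong₂ _*_ ones (cong g (sym p≡1+[p-1])) ⟩
    1 * g p                          ≡⟨ *-identityˡ (g p) ⟩
    g p                              ≡⟨ ifDiv-∣ _ 1 (∣m∣n⇒∣m+n (m∣m*n r) ∣-refl) ⟩
    c + (p * r + p)                  ∎
    where
    open ≡-Reasoning
    g = λ t → pFactor c (p * r + t)
    ones : Π (pred p) g ≡ 1
    ones = Π-ones (pred p) λ t 0<t t≤p-1 → ifDiv-∤ _ 1 λ p∣pr+t →
      ∤-below 0<t (subst (t <_) (sym p≡1+[p-1]) (s≤s t≤p-1)) (∣m+n∣m⇒∣n p∣pr+t (m∣m*n r))

  pPart-multiple : ∀ s r → pPart (p * s) (p * r) ≡ p ^ r * rising s r
  pPart-multiple s zero    = cong (λ z → Π z (pFactor (p * s))) (*-zeroʳ p)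
  pPart-multiple s (suc r) = begin
    pPart (p * s) (p * suc r)       ≡⟨ cong (pPart (p * s)) (trans (*-suc p r) (+-comm p (p * r))) ⟩
    pPart (p * s) (p * r + p)       ≡⟨ Π-split (p * r) p (pFactor (p * s)) ⟩
    pPart (p * s) (p * r) * Π p (λ t → pFactor (p * s) (p * r + t))
                                    ≡⟨ cong₂ _*_ (pPart-multiple s r) (pPart-block (p * s) r) ⟩
    p ^ r * rising s r * (p * s + (p * r + p))
                                    ≡⟨ collect p r s (p ^ r) (rising s r) ⟩
    p * p ^ r * (rising s r * (s + suc r)) ∎
    where
    open ≡-Reasoning
    collect : ∀ p r s a b → a * b * (p * s + (p * r + p)) ≡ p * a * (b * (s + suc r))
    collect = solve-∀

  -- In  2 B q · q! = (q+1)⋯(2q)  the p-parts are  p^r r!  and  p^r (r+1)⋯(2r) = p^r · 2 B r · r!;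
  -- cancelling  2 p^r r!  leaves the unit parts.
  B-unitPart : ∀ r → 1 ≤ r → B (p * r) * unitPart 0 (p * r) ≡ B r * unitPart (p * r) (p * r)
  B-unitPart r 1≤r = *-cancelʳ-≡ _ _ K {{K≢0}} (begin
    B q * U₀ * K                         ≡⟨ reorder₁ (B q) U₀ (p ^ r) (rising 0 r) ⟩
    B q * 2 * (U₀ * (p ^ r * rising 0 r)) ≡⟨ cong (λ z → B q * 2 * (U₀ * z)) (sym pPart-0) ⟩
    B q * 2 * (U₀ * pPart 0 q)           ≡⟨ cong (B q * 2 *_) (rising-split 0 q) ⟨
    B q * 2 * rising 0 q                 ≡⟨ B-rising q 1≤q ⟩
    rising q q                           ≡⟨ rising-split q q ⟩
    U_q * pPart q q                      ≡⟨ cong (U_q *_) (pPart-multiple r r) ⟩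
    U_q * (p ^ r * rising r r)           ≡⟨ cong (λ z → U_q * (p ^ r * z)) (B-rising r 1≤r) ⟨
    U_q * (p ^ r * (B r * 2 * rising 0 r)) ≡⟨ reorder₂ U_q (p ^ r) (B r) (rising 0 r) ⟩
    B r * U_q * K                        ∎)
    where
    open ≡-Reasoning
    q = p * r
    U₀ = unitPart 0 q
    U_q = unitPart q q
    K = 2 * (p ^ r * rising 0 r)
    K≢0 : NonZero K
    K≢0 = subst (λ z → NonZero (2 * (p ^ r * z))) (sym (rising-0 r))
                (m*n≢0 2 _ {{_}} {{m*n≢0 (p ^ r) (r !) {{m^n≢0 p r}} {{r !≢0}}}})
    1≤q : 1 ≤ q
    1≤q = *-mono-≤ {1} {p} {1} {r} (<⇒≤ (prime>1 pp)) 1≤r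
    pPart-0 : pPart 0 q ≡ p ^ r * rising 0 r
    pPart-0 = trans (cong (λ z → Π q (pFactor z)) (sym (*-zeroʳ p))) (pPart-multiple 0 r)
    reorder₁ : ∀ b u a f → b * u * (2 * (a * f)) ≡ b * 2 * (u * (a * f))
    reorder₁ = solve-∀
    reorder₂ : ∀ u a b f → u * (a * (b * 2 * f)) ≡ b * u * (2 * (a * f))
    reorder₂ = solve-∀

-- Pairing j with q - j gives  (q + j)(2q - j) = j (q - j) + 2q²,  so X² is a
-- first-order perturbation of Y² in ε = 2q².
module Pairing (p : ℕ) (pp : Prime p) (n : ℕ) (p∣q : p ∣ℕ suc n) where
  open import Data.Nat.Divisibility using (_∣_)
  import Data.Nat as ℕ
  import Data.Nat.Properties as ℕ
  import Data.Nat.Divisibility as ℕ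
  open import Data.Nat using (_∸_)
  open import Data.Nat.Tactic.RingSolver using () renaming (solve-∀ to solveℕ)
  open import Data.Integer using (ℤ; +_; _+_; _-_; _*_)
  open import Data.Integer.Properties using (pos-*; pos-+; *-identityˡ; +-identityʳ)
  open import Data.Integer.Divisibility.Signed using (∣ᵤ⇒∣; ∣⇒∣ᵤ; ∣m⇒∣m*n) renaming (_∣_ to _∣ℤ_)
  open import Data.Integer.Tactic.RingSolver using (solve-∀)
  open import Relation.Binary.PropositionalEquality
  open import Relation.Nullary using (¬_; yes; no)
  open import Data.Sum using ([_,_]′)
  open Iterated using (Forall₁)
  open import Data.Empty using (⊥-elim)
  open Arithmetic using (prime>1; prime∤1; cube)
  open IntCongruence
  open IntProducts
  open CentralBinomial using (B)
  open PrimeSplitting p pp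

  q : ℕ
  q = suc n

  -- The unit parts of (q+1)⋯(2q) and of q!, without their trivial last factor.
  X Y : ℤ
  X = Πℤ n (λ j → + unitFactor q j)
  Y = Πℤ n (λ j → + unitFactor 0 j)

  unitPart-q : ∀ c → + unitPart c q ≡ Πℤ n (λ j → + unitFactor c j)
  unitPart-q c = trans (cong +_ (trans (cong (unitPart c n ℕ.*_) (ifDiv-∣ 1 _ p∣q)) (ℕ.*-identityʳ _)))
                       (Π-cast n (unitFactor c))

  W E : ℕ → ℕ
  W j = ifDiv j 1 (j ℕ.* (q ∸ j))
  E j = ifDiv j 0 1

  ε : ℤ
  ε = + (2 ℕ.* (q ℕ.* q))

  w e : ℕ → ℤ
  w j = + W j
  e j = + E j

  ∣-reflect : ∀ {j} → j ℕ.≤ q → p ∣ j → p ∣ q ∸ j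
  ∣-reflect j≤q p∣j = ℕ.∣m+n∣m⇒∣n (subst (p ∣_) (sym (ℕ.m+[n∸m]≡n j≤q)) p∣q) p∣j

  ∣-reflect⁻ : ∀ {j} → j ℕ.≤ q → p ∣ q ∸ j → p ∣ j
  ∣-reflect⁻ j≤q p∣q-j = ℕ.∣m+n∣m⇒∣n (subst (p ∣_) (sym (ℕ.m∸n+n≡m j≤q)) p∣q) p∣q-j

  pair-identity : ∀ j → j ℕ.≤ q → (q ℕ.+ j) ℕ.* (q ℕ.+ (q ∸ j)) ≡ j ℕ.* (q ∸ j) ℕ.+ 2 ℕ.* (q ℕ.* q) ℕ.* 1
  pair-identity j j≤q =
    subst (λ Q → (Q ℕ.+ j) ℕ.* (Q ℕ.+ k) ≡ j ℕ.* k ℕ.+ 2 ℕ.* (Q ℕ.* Q) ℕ.* 1) (ℕ.m+[n∸m]≡n j≤q) (identity j k)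
    where
    k = q ∸ j
    identity : ∀ j k → ((j ℕ.+ k) ℕ.+ j) ℕ.* ((j ℕ.+ k) ℕ.+ k) ≡ j ℕ.* k ℕ.+ 2 ℕ.* ((j ℕ.+ k) ℕ.* (j ℕ.+ k)) ℕ.* 1
    identity = solveℕ

  pair-X : Forall₁ n (λ j → unitFactor q j ℕ.* unitFactor q (q ∸ j) ≡ W j ℕ.+ 2 ℕ.* (q ℕ.* q) ℕ.* E j)
  pair-X j _ j≤n with p ℕ.∣? j | p ℕ.∣? (q ∸ j)
  ... | yes _     | yes _     = cong (1 ℕ.+_) (sym (ℕ.*-zeroʳ (2 ℕ.* (q ℕ.* q))))
  ... | yes p∣j   | no  p∤q-j = ⊥-elim (p∤q-j (∣-reflect (ℕ.m≤n⇒m≤1+n j≤n) p∣j))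
  ... | no  p∤j   | yes p∣q-j = ⊥-elim (p∤j (∣-reflect⁻ (ℕ.m≤n⇒m≤1+n j≤n) p∣q-j))
  ... | no  _     | no  _     = pair-identity j (ℕ.m≤n⇒m≤1+n j≤n)

  pair-Y : Forall₁ n (λ j → unitFactor 0 j ℕ.* unitFactor 0 (q ∸ j) ≡ W j)
  pair-Y j _ j≤n with p ℕ.∣? j | p ℕ.∣? (q ∸ j)
  ... | yes _     | yes _     = refl
  ... | yes p∣j   | no  p∤q-j = ⊥-elim (p∤q-j (∣-reflect (ℕ.m≤n⇒m≤1+n j≤n) p∣j))
  ... | no  p∤j   | yes p∣q-j = ⊥-elim (p∤j (∣-reflect⁻ (ℕ.m≤n⇒m≤1+n j≤n) p∣q-j))
  ... | no  _     | no  _     = refl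

  square-paired : ∀ c → Πℤ n (λ j → + unitFactor c j) * Πℤ n (λ j → + unitFactor c j)
                        ≡ Πℤ n (λ j → + (unitFactor c j ℕ.* unitFactor c (q ∸ j)))
  square-paired c = begin
    Z * Z                                              ≡⟨ cong (Z *_) (Πℤ-reverse n f) ⟩
    Z * Πℤ n (λ j → f (q ∸ j))                         ≡⟨ Πℤ-* n f (λ j → f (q ∸ j)) ⟨
    Πℤ n (λ j → f j * f (q ∸ j))                       ≡⟨ Πℤ-cong n (λ j _ _ → sym (pos-* (unitFactor c j) _)) ⟩
    Πℤ n (λ j → + (unitFactor c j ℕ.* unitFactor c (q ∸ j))) ∎
    where
    open ≡-Reasoning
    f = λ j → + unitFactor c j
    Z = Πℤ n f

  open FirstOrder ε w e public

  -- X² = Π (w j + ε e j)  and  Y² = Π w j,  so  X² ≡ Y² + ε Π′ (mod ε²).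
  X²-expansion : X * X ≡ Y * Y + ε * Π′ n ⟨mod ε * ε ⟩
  X²-expansion = subst₂ (λ u v → u ≡ v + ε * Π′ n ⟨mod ε * ε ⟩) (sym X²) (sym Y²) (expansion n)
    where
    X² : X * X ≡ Πℤ n (λ j → w j + ε * e j)
    X² = trans (square-paired q) (Πℤ-cong n λ j 1≤j j≤n →
           trans (cong +_ (pair-X j 1≤j j≤n)) (trans (pos-+ (W j) _) (cong (λ z → w j + z) (pos-* (2 ℕ.* (q ℕ.* q)) (E j)))))
    Y² : Y * Y ≡ Πℤ n w
    Y² = trans (square-paired 0) (Πℤ-cong n λ j 1≤j j≤n → cong +_ (pair-Y j 1≤j j≤n))

  -- Factorwise  q + j ≡ j (mod q).
  X≡Y-mod-q : X ≡ Y ⟨mod + q ⟩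
  X≡Y-mod-q = Πℤ-mod n factor
    where
    factor : Forall₁ n (λ j → + unitFactor q j ≡ + unitFactor 0 j ⟨mod + q ⟩)
    factor j _ _ with p ℕ.∣? j
    ... | yes _ = mod-refl
    ... | no  _ = subst (λ z → z ≡ + j ⟨mod + q ⟩)
                        (trans (cong (λ z → + j + z) (*-identityˡ (+ q))) (trans (sym (pos-+ j q)) (cong +_ (ℕ.+-comm j q))))
                        (mod-multiple (+ j) (+ 1))

  p∤Y : ¬ (+ p ∣ℤ Y)
  p∤Y = Πℤ-∤ pp n factor
    where
    factor : Forall₁ n (λ j → ¬ (+ p ∣ℤ + unitFactor 0 j))
    factor j _ _ with p ℕ.∣? j
    ... | yes _   = λ p∣1 → prime∤1 pp (∣⇒∣ᵤ p∣1)
    ... | no  p∤j = λ p∣j → p∤j (∣⇒∣ᵤ p∣j)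

  -- For odd p:  X + Y ≡ 2Y (mod p)  is prime to p.
  p∤X+Y : p ≢ 2 → ¬ (+ p ∣ℤ X + Y)
  p∤X+Y p≢2 p∣X+Y = [ p∤2 , p∤Y ]′ (euclidsLemmaℤ pp (+ 2) Y p∣2Y)
    where
    p∤2 : ¬ (+ p ∣ℤ + 2)
    p∤2 p∣2 = p≢2 (ℕ.≤-antisym (ℕ.∣⇒≤ (∣⇒∣ᵤ p∣2)) (prime>1 pp))
    X+Y≡Y+Y : X + Y ≡ Y + Y ⟨mod + p ⟩
    X+Y≡Y+Y = mod-+ (mod-weaken (∣ᵤ⇒∣ p∣q) X≡Y-mod-q) (mod-refl {a = Y})
    double : ∀ Y → Y + Y ≡ + 2 * Y
    double = solve-∀
    p∣2Y : + p ∣ℤ + 2 * Y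
    p∣2Y = subst (+ p ∣ℤ_) (double Y) (mod-∣ X+Y≡Y+Y p∣X+Y)

  X≡Y-mod-p³ : p ≢ 2 → + (p ℕ.^ 3) ∣ℤ ε * ε → + (p ℕ.^ 3) ∣ℤ ε * Π′ n → X ≡ Y ⟨mod + (p ℕ.^ 3) ⟩
  X≡Y-mod-p³ p≢2 p³∣ε² p³∣εΠ′ = mod-square-root pp 3 X Y (p∤X+Y p≢2)
    (mod-trans (mod-weaken p³∣ε² X²-expansion)
               (subst (λ z → Y * Y + ε * Π′ n ≡ z ⟨mod _ ⟩) (+-identityʳ (Y * Y))
                      (mod-+ (mod-refl {a = Y * Y}) (mod-0 p³∣εΠ′))))

  -- By  B (p r) · unitPart 0 q = B r · unitPart q q,  i.e.  B q · Y = B r · X,  and p ∤ Y: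
  -- X ≡ Y (mod p^k) gives  B q ≡ B r (mod p^k).
  B-reduction : ∀ k r → 1 ℕ.≤ r → p ℕ.* r ≡ q → X ≡ Y ⟨mod + (p ℕ.^ k) ⟩ →
                + B (p ℕ.* r) ≡ + B r ⟨mod + (p ℕ.^ k) ⟩
  B-reduction k r 1≤r pr≡q X≡Y =
    subst (λ z → + B z ≡ + B r ⟨mod + (p ℕ.^ k) ⟩) (sym pr≡q) (mod-cancel pp k Y p∤Y
    (subst₂ (λ a b → a ≡ b ⟨mod _ ⟩) (*-comm-Y (B q)) (*-comm-Y (B r))
      (mod-trans (≡⇒≡-mod BqY≡BrX) (mod-* (mod-refl {a = + B r}) X≡Y))))
    where
    *-comm-Y : ∀ b → + b * Y ≡ Y * + b
    *-comm-Y b = Data.Integer.Properties.*-comm (+ b) Y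
    BqY≡BrX : + B q * Y ≡ + B r * X
    BqY≡BrX = begin
      + B q * Y                    ≡⟨ cong (+ B q *_) (unitPart-q 0) ⟨
      + B q * + unitPart 0 q       ≡⟨ pos-* (B q) _ ⟨
      + (B q ℕ.* unitPart 0 q)     ≡⟨ cong +_ reduction ⟩
      + (B r ℕ.* unitPart q q)     ≡⟨ pos-* (B r) _ ⟩
      + B r * + unitPart q q       ≡⟨ cong (+ B r *_) (unitPart-q q) ⟩
      + B r * X                    ∎
      where
      open ≡-Reasoning
      reduction : B q ℕ.* unitPart 0 q ≡ B r ℕ.* unitPart q q
      reduction = subst (λ z → B z ℕ.* unitPart 0 z ≡ B r ℕ.* unitPart z z) pr≡q (B-unitPart r 1≤r)

  -- If p is odd and p² ∣ q, then p³ ∣ ε = 2q², so X ≡ Y (mod p³).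
  X≡Y-if-p²∣q : p ≢ 2 → p ℕ.* p ∣ q → X ≡ Y ⟨mod + (p ℕ.^ 3) ⟩
  X≡Y-if-p²∣q p≢2 p²∣q = X≡Y-mod-p³ p≢2 (∣m⇒∣m*n ε p³∣ε) (∣m⇒∣m*n (Π′ n) p³∣ε)
    where
    p³∣ε : + (p ℕ.^ 3) ∣ℤ ε
    p³∣ε = ∣ᵤ⇒∣ (ℕ.∣n⇒∣m*n 2 (subst (ℕ._∣ q ℕ.* q) (cube p) (ℕ.*-pres-∣ p²∣q p∣q)))

-- The base case q = p ≥ 5: every j (1 ≤ j < p) contributes  e j = 1  and
-- w j = j (p - j) ≡ -j²,  so by Fermat  w j · (-j^(p-3)) ≡ 1 (mod p).  Hence
-- Π′ ≡ -(Π w) · S(p-3) ≡ 0 (mod p), as p ∣ 1^(p-3) + … + (p-1)^(p-3).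
module Wolstenholme (k : ℕ) (pp : Prime (5 ℕ.+ k)) where
  open Iterated using (Forall₁)
  import Data.Nat.Properties as ℕ
  import Data.Nat.Divisibility as ℕ
  open import Data.Nat using (_∸_; s≤s; z≤n)
  open import Data.Integer using (ℤ; +_; -_; _+_; _-_; _*_)
  open import Data.Integer.Properties using (pos-*; m-n≡m⊖n; ⊖-≥)
  open import Data.Integer.Divisibility.Signed using (∣ᵤ⇒∣; ∣m⇒∣-m; ∣n⇒∣m*n) renaming (_∣_ to _∣ℤ_)
  open import Data.Integer.Tactic.RingSolver using (solve-∀)
  open import Relation.Binary.PropositionalEquality
  open Arithmetic using (∤-below; fermat-unit; powerSum-∣; cube)
  open IntCongruence
  open IntProducts
  open CentralBinomial using (B)

  p n : ℕ
  p = 5 ℕ.+ k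
  n = 4 ℕ.+ k

  open PrimeSplitting p pp using (ifDiv-∤)
  open Pairing p pp n ℕ.∣-refl

  -- y j = -j^(p-3), the inverse of w j modulo p
  y : ℕ → ℤ
  y j = - + (j ℕ.^ (2 ℕ.+ k))

  w·y≡e : Forall₁ n (λ j → w j * y j ≡ e j ⟨mod + p ⟩)
  w·y≡e j 1≤j j≤n = mod-trans (≡⇒≡-mod wy≡) (mod-trans (mod-multiple (+ (j ℕ.^ n)) (- (+ j * T))) j^[p-1]≡1)
    where
    p∤j = ∤-below 1≤j (s≤s j≤n)
    T = + (j ℕ.^ (2 ℕ.+ k))
    pos∸ : + (p ∸ j) ≡ + p - + j
    pos∸ = sym (trans (m-n≡m⊖n p j) (⊖-≥ (ℕ.m≤n⇒m≤1+n j≤n)))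
    j^n≡ : + (j ℕ.^ n) ≡ + j * (+ j * T)
    j^n≡ = trans (pos-* j _) (cong (+ j *_) (pos-* j _))
    expand : ∀ J P T → (J * (P - J)) * (- T) ≡ J * (J * T) + (- (J * T)) * P
    expand = solve-∀
    wy≡ : w j * y j ≡ + (j ℕ.^ n) + (- (+ j * T)) * + p
    wy≡ = begin
      w j * y j                                  ≡⟨ cong (λ z → + z * y j) (ifDiv-∤ 1 _ p∤j) ⟩
      + (j ℕ.* (p ∸ j)) * - T                    ≡⟨ cong (λ z → z * - T) (trans (pos-* j _) (cong (+ j *_) pos∸)) ⟩
      (+ j * (+ p - + j)) * - T                  ≡⟨ expand (+ j) (+ p) T ⟩
      + j * (+ j * T) + (- (+ j * T)) * + p      ≡⟨ cong (λ z → z + (- (+ j * T)) * + p) j^n≡ ⟨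
      + (j ℕ.^ n) + (- (+ j * T)) * + p          ∎
      where open ≡-Reasoning
    j^[p-1]≡1 : + (j ℕ.^ n) ≡ e j ⟨mod + p ⟩
    j^[p-1]≡1 = subst (λ z → + (j ℕ.^ n) ≡ + z ⟨mod + p ⟩) (sym (ifDiv-∤ 0 1 p∤j))
      (mod-intro (subst (+ p ∣ℤ_) (sym (trans (m-n≡m⊖n (j ℕ.^ n) 1) (⊖-≥ (ℕ.m^n>0 j {{ℕ.>-nonZero 1≤j}} n))))
                        (∣ᵤ⇒∣ (fermat-unit pp j p∤j))))

  p∣Π′ : + p ∣ℤ Π′ n
  p∣Π′ = mod-∣ (mod-sym (derivative-mod n y w·y≡e)) (∣n⇒∣m*n (Πℤ n w) p∣Σy)
    where
    p∣Σy : + p ∣ℤ Σℤ n y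
    p∣Σy = subst (+ p ∣ℤ_) (sym (Σℤ-neg n (λ j → j ℕ.^ (2 ℕ.+ k))))
      (∣m⇒∣-m (∣ᵤ⇒∣ (powerSum-∣ pp (2 ℕ.+ k) p-3<p-1 (2 ℕ.+ k) (s≤s z≤n) ℕ.≤-refl)))
      where
      p-3<p-1 : 2 ℕ.+ k ℕ.< n
      p-3<p-1 = ℕ.m<n+m (2 ℕ.+ k) {2} (s≤s z≤n)

  -- p³ divides both ε² and ε Π′, since p² ∣ ε = 2p².
  X≡Y : X ≡ Y ⟨mod + (p ℕ.^ 3) ⟩
  X≡Y = X≡Y-mod-p³ (λ ()) (subst (_∣ℤ ε * ε) p³ (∣-* p²∣ε p∣ε)) (subst (_∣ℤ ε * Π′ n) p³ (∣-* p²∣ε p∣Π′))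
    where
    p²∣ε : + (p ℕ.* p) ∣ℤ ε
    p²∣ε = ∣ᵤ⇒∣ (ℕ.∣n⇒∣m*n 2 ℕ.∣-refl)
    p∣ε : + p ∣ℤ ε
    p∣ε = ∣ᵤ⇒∣ (ℕ.∣n⇒∣m*n 2 (ℕ.∣m⇒∣m*n p ℕ.∣-refl))
    p³ : + (p ℕ.* p ℕ.* p) ≡ + (p ℕ.^ 3)
    p³ = cong +_ (cube p)

  -- Wolstenholme's theorem  C(2p-1, p-1) ≡ 1 (mod p³),  by one reduction step to B 1 = 1.
  B-prime : + B p ≡ + 1 ⟨mod + (p ℕ.^ 3) ⟩
  B-prime = subst (λ z → + B z ≡ + 1 ⟨mod + (p ℕ.^ 3) ⟩) (ℕ.*-identityʳ p)
                  (B-reduction 3 1 (s≤s z≤n) (ℕ.*-identityʳ p) X≡Y)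

module Lifting where
  import Data.Nat.Properties as ℕ
  import Data.Nat.Divisibility as ℕ
  open import Data.Nat using (zero; suc; pred; s≤s; z≤n; _≟_)
  open import Data.Nat.Primality using (prime[2]; prime⇒nonZero; ¬prime[0]; ¬prime[1]; euclidsLemma)
  open import Data.Nat.Tactic.RingSolver using (solve-∀)
  open import Data.Integer using (+_)
  open import Data.Integer.Divisibility.Signed using (divides; ∣ᵤ⇒∣)
  open import Relation.Binary.PropositionalEquality
  open import Relation.Nullary using (yes; no)
  open import Data.Sum using (inj₁; inj₂)
  open import Data.Product using (∃; _,_)
  open import Data.Empty using (⊥-elim)
  open import Defs using (iv)
  open Arithmetic using (prime>1)
  open IntCongruence
  open CentralBinomial using (B)

  -- A positive m written as n + 1, as the pairing argument requires.
  1+pred : ∀ m → 1 ℕ.≤ m → m ≡ suc (pred m)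
  1+pred (suc m) _ = refl

  B-lift-odd : ∀ {p} (pp : Prime p) → p ≢ 2 → ∀ a → + B (p ℕ.^ suc a) ≡ + B p ⟨mod + (p ℕ.^ 3) ⟩
  B-lift-odd {p} pp p≢2 zero    = ≡⇒≡-mod (cong (λ z → + B z) (ℕ.*-identityʳ p))
  B-lift-odd {p} pp p≢2 (suc a) =
    mod-trans (B-reduction 3 r 1≤r pr≡q (X≡Y-if-p²∣q p≢2 p²∣q)) (B-lift-odd pp p≢2 a)
    where
    r = p ℕ.^ suc a
    1≤r : 1 ℕ.≤ r
    1≤r = ℕ.m^n>0 p {{prime⇒nonZero pp}} (suc a)
    pr≡q : p ℕ.* r ≡ suc (pred (p ℕ.* r))
    pr≡q = 1+pred _ (ℕ.*-mono-≤ {1} {p} {1} {r} (ℕ.<⇒≤ (prime>1 pp)) 1≤r)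
    open Pairing p pp (pred (p ℕ.* r)) (subst (p ℕ.∣_) pr≡q (ℕ.m∣m*n r))
    p²∣q : p ℕ.* p ℕ.∣ suc (pred (p ℕ.* r))
    p²∣q = subst (p ℕ.* p ℕ.∣_) pr≡q (ℕ.*-monoʳ-∣ p (ℕ.m∣m*n (p ℕ.^ a)))

  -- For p = 2:  B (2^(a+1)) ≡ 3 (mod 8).  Beyond B 2 = 3 and B 4 = 35 the pairing
  -- congruence X ≡ Y modulo q itself suffices, as 8 ∣ q.
  B-lift-two : ∀ a → + B (2 ℕ.^ suc a) ≡ + 3 ⟨mod + 8 ⟩
  B-lift-two zero          = mod-refl
  B-lift-two (suc zero)    = mod-intro (divides (+ 4) refl)
  B-lift-two (suc (suc a)) =
    mod-trans (B-reduction 3 r 1≤r pr≡q (mod-weaken (∣ᵤ⇒∣ 8∣q) X≡Y-mod-q)) (B-lift-two (suc a))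
    where
    r = 2 ℕ.^ suc (suc a)
    1≤r : 1 ℕ.≤ r
    1≤r = ℕ.m^n>0 2 (suc (suc a))
    pr≡q : 2 ℕ.* r ≡ suc (pred (2 ℕ.* r))
    pr≡q = 1+pred _ (ℕ.m^n>0 2 (suc (suc (suc a))))
    open Pairing 2 prime[2] (pred (2 ℕ.* r)) (subst (2 ℕ.∣_) pr≡q (ℕ.m∣m*n r))
    eight : ∀ x → 2 ℕ.* (2 ℕ.* (2 ℕ.* x)) ≡ x ℕ.* 8
    eight = solve-∀
    8∣q : 8 ℕ.∣ suc (pred (2 ℕ.* r))
    8∣q = subst (8 ℕ.∣_) pr≡q (ℕ.divides (2 ℕ.^ a) (eight (2 ℕ.^ a)))

  prime≥5 : ∀ {p} → Prime p → p ≢ 2 → p ≢ 3 → ∃ λ k → p ≡ 5 ℕ.+ k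
  prime≥5 {0} pp _ _ = ⊥-elim (¬prime[0] pp)
  prime≥5 {1} pp _ _ = ⊥-elim (¬prime[1] pp)
  prime≥5 {2} _ p≢2 _ = ⊥-elim (p≢2 refl)
  prime≥5 {3} _ _ p≢3 = ⊥-elim (p≢3 refl)
  prime≥5 {4} pp _ _ with euclidsLemma 2 2 pp (ℕ.divides 1 refl)
  ... | inj₁ 4∣2 = ⊥-elim (ℕ.<⇒≱ (s≤s (s≤s (s≤s z≤n))) (ℕ.∣⇒≤ 4∣2))
  ... | inj₂ 4∣2 = ⊥-elim (ℕ.<⇒≱ (s≤s (s≤s (s≤s z≤n))) (ℕ.∣⇒≤ 4∣2))
  prime≥5 {suc (suc (suc (suc (suc k))))} _ _ _ = k , refl

  iv-≢ : ∀ {p q} → p ≢ q → iv p q ≡ 0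
  iv-≢ {p} {q} p≢q with p ≟ q
  ... | yes p≡q = ⊥-elim (p≢q p≡q)
  ... | no  _   = refl

  B-mod-p³ : ∀ {p} (pp : Prime p) a → 1 ℕ.≤ a →
             + B (p ℕ.^ a) ≡ + (1 ℕ.+ (p ℕ.* iv p 2 ℕ.+ p ℕ.^ 2 ℕ.* iv p 3)) ⟨mod + (p ℕ.^ 3) ⟩
  B-mod-p³ {p} pp (suc a) _ with p ≟ 2
  ... | yes refl = B-lift-two a
  ... | no p≢2 with p ≟ 3
  ...   | yes refl = B-lift-odd pp p≢2 a
  ...   | no p≢3 with prime≥5 pp p≢2 p≢3
  ...     | k , refl = subst (λ t → + B (p ℕ.^ suc a) ≡ + (1 ℕ.+ t) ⟨mod + (p ℕ.^ 3) ⟩) (sym no-correction)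
                       (mod-trans (B-lift-odd pp p≢2 a) (Wolstenholme.B-prime k pp))
    where
    no-correction : p ℕ.* iv p 2 ℕ.+ p ℕ.^ 2 ℕ.* iv p 3 ≡ 0
    no-correction = cong₂ ℕ._+_ (trans (cong (p ℕ.*_) (iv-≢ p≢2)) (ℕ.*-zeroʳ p))
                                 (trans (cong (p ℕ.^ 2 ℕ.*_) (iv-≢ p≢3)) (ℕ.*-zeroʳ (p ℕ.^ 2)))

-- The identity  Σ_{k=1}^{N} C(2k,k) + 2 Σ_{k=1}^{N} C(2k,k+1) + 2 = 2 B (N+1),
-- by induction on N: both new summands are expressed through Pascal's rule
-- and the symmetry of binomial coefficients.
module CentralBinomialSum where
  open import Data.Nat
  open import Data.Nat.Properties
  open import Data.Nat.Combinatorics using (_C_; nCk≡nC[n∸k]; nCk+nC[k+1]≡[n+1]C[k+1])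
  open import Data.Nat.Tactic.RingSolver using (solve-∀)
  open import Relation.Binary.PropositionalEquality
  open Arithmetic using (Σ)
  open CentralBinomial using (B; 2[N+1]∸1)

  -- The two sums of the theorem, with q - 1 = N terms.
  S₁ S₂ : ℕ → ℕ
  S₁ N = Σ N (λ k → (2 * k) C k)
  S₂ N = Σ N (λ k → (2 * k) C (k + 1))

  middle≡2B : ∀ N → suc (suc (N + N)) C suc N ≡ B (suc N) + B (suc N)
  middle≡2B N = begin
    suc m C suc N              ≡⟨ nCk+nC[k+1]≡[n+1]C[k+1] m N ⟨
    m C N + m C suc N          ≡⟨ cong (m C N +_) (trans (nCk≡nC[n∸k] (s≤s (m≤m+n N N))) (cong (m C_) (m+n∸n≡m N N))) ⟩
    m C N + m C N              ≡⟨ cong (λ x → x C N + x C N) (2[N+1]∸1 N) ⟨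
    B (suc N) + B (suc N)      ∎
    where
    open ≡-Reasoning
    m = suc (N + N)

  B-pascal : ∀ N → B (suc (suc N)) ≡ suc (suc (N + N)) C suc (suc N) + suc (suc (N + N)) C suc N
  B-pascal N = begin
    B (suc (suc N))            ≡⟨ cong (λ x → (x ∸ 1) C suc N) (double N) ⟩
    suc a C suc N              ≡⟨ nCk+nC[k+1]≡[n+1]C[k+1] a N ⟨
    a C N + a C suc N          ≡⟨ cong (_+ a C suc N) (trans (nCk≡nC[n∸k] N≤a) (cong (a C_) (m+n∸n≡m (suc (suc N)) N))) ⟩
    a C suc (suc N) + a C suc N ∎
    where
    open ≡-Reasoning
    a = suc (suc (N + N))
    N≤a : N ≤ a
    N≤a = m≤n⇒m≤1+n (m≤n⇒m≤1+n (m≤m+n N N))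
    double : ∀ N → 2 * suc (suc N) ≡ suc (suc (suc (suc (N + N))))
    double = solve-∀

  B-sum : ∀ N → S₁ N + 2 * S₂ N + 2 ≡ 2 * B (suc N)
  B-sum zero    = refl
  B-sum (suc N) = begin
    (S₁ N + F′) + 2 * (S₂ N + G′) + 2  ≡⟨ cong₂ (λ x y → (S₁ N + x) + 2 * (S₂ N + y) + 2) F′≡F G′≡G ⟩
    (S₁ N + F) + 2 * (S₂ N + G) + 2    ≡⟨ regroup (S₁ N) (S₂ N) F G ⟩
    (S₁ N + 2 * S₂ N + 2) + F + 2 * G  ≡⟨ cong (λ x → x + F + 2 * G) (B-sum N) ⟩
    2 * c + F + 2 * G                  ≡⟨ cong (λ x → 2 * c + x + 2 * G) (middle≡2B N) ⟩
    2 * c + (c + c) + 2 * G            ≡⟨ regroup′ c G ⟩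
    2 * (G + (c + c))                  ≡⟨ cong (λ x → 2 * (G + x)) (middle≡2B N) ⟨
    2 * (G + F)                        ≡⟨ cong (2 *_) (B-pascal N) ⟨
    2 * B (suc (suc N))                ∎
    where
    open ≡-Reasoning
    a = suc (suc (N + N))
    c = B (suc N)
    F′ = (2 * suc N) C suc N
    G′ = (2 * suc N) C (suc N + 1)
    F = a C suc N
    G = a C suc (suc N)
    2[N+1] : ∀ N → 2 * suc N ≡ suc (suc (N + N))
    2[N+1] = solve-∀
    F′≡F : F′ ≡ F
    F′≡F = cong (_C suc N) (2[N+1] N)
    G′≡G : G′ ≡ G
    G′≡G = cong₂ _C_ (2[N+1] N) (+-comm (suc N) 1)
    regroup : ∀ s₁ s₂ f g → (s₁ + f) + 2 * (s₂ + g) + 2 ≡ (s₁ + 2 * s₂ + 2) + f + 2 * g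
    regroup = solve-∀
    regroup′ : ∀ c g → 2 * c + (c + c) + 2 * g ≡ 2 * (g + (c + c))
    regroup′ = solve-∀

-- Moving the statements from ℕ and ℤ into ℚ: rational equalities are checked
-- through the injective ring homomorphism  toℚᵘ  into unnormalised rationals,
-- where they become cross-multiplied integer identities.
module RationalTransfer where
  open import Data.Nat as ℕ using (ℕ; zero; suc)
  import Data.Nat.Properties as ℕ
  open import Data.Integer as ℤ using (ℤ; +_)
  import Data.Integer.Properties as ℤ
  open import Data.Integer.GCD using (gcd)
  open import Data.Integer.Tactic.RingSolver using (solve-∀)
  open import Data.Rational as ℚ using (ℚ; ½; toℚᵘ; ↧ₙ_; ↧_)
  open import Data.Rational.Properties using (toℚᵘ-injective; toℚᵘ-homo-+; toℚᵘ-homo-*; toℚᵘ-homo‿-; toℚᵘ-fromℚᵘ; ↧-/)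
  open import Data.Rational.Unnormalised as ℚᵘ using (ℚᵘ; mkℚᵘ; *≡*) renaming (_≃_ to _≃ᵘ_)
  import Data.Rational.Unnormalised.Properties as ℚᵘ
  open import Relation.Binary.PropositionalEquality
  open import Defs using (nℚ; sum1to)
  open Arithmetic using (Σ)

  ι : ℤ → ℚᵘ
  ι z = mkℚᵘ z 0

  toℚᵘ-int : ∀ z → toℚᵘ (z ℚ./ 1) ≃ᵘ ι z
  toℚᵘ-int z = toℚᵘ-fromℚᵘ (ι z)

  toℚᵘ-minus : ∀ x y → toℚᵘ (x ℚ.- y) ≃ᵘ toℚᵘ x ℚᵘ.- toℚᵘ y
  toℚᵘ-minus x y = ℚᵘ.≃-trans (toℚᵘ-homo-+ x (ℚ.- y)) (ℚᵘ.+-congʳ (toℚᵘ x) (toℚᵘ-homo‿- y))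

  toℚᵘ-nℚ-minus : ∀ a b → toℚᵘ (nℚ a ℚ.- nℚ b) ≃ᵘ ι (+ a) ℚᵘ.- ι (+ b)
  toℚᵘ-nℚ-minus a b = ℚᵘ.≃-trans (toℚᵘ-minus (nℚ a) (nℚ b)) (ℚᵘ.+-cong (toℚᵘ-int (+ a)) (ℚᵘ.-‿cong (toℚᵘ-int (+ b))))

  nℚ-+ : ∀ a b → nℚ a ℚ.+ nℚ b ≡ nℚ (a ℕ.+ b)
  nℚ-+ a b = toℚᵘ-injective (begin
    toℚᵘ (nℚ a ℚ.+ nℚ b)            ≈⟨ toℚᵘ-homo-+ (nℚ a) (nℚ b) ⟩
    toℚᵘ (nℚ a) ℚᵘ.+ toℚᵘ (nℚ b)    ≈⟨ ℚᵘ.+-cong (toℚᵘ-int (+ a)) (toℚᵘ-int (+ b)) ⟩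
    ι (+ a) ℚᵘ.+ ι (+ b)            ≈⟨ *≡* (trans (cross (+ a) (+ b)) (cong (ℤ._* + 1) (sym (ℤ.pos-+ a b)))) ⟩
    ι (+ (a ℕ.+ b))                 ≈⟨ toℚᵘ-int (+ (a ℕ.+ b)) ⟨
    toℚᵘ (nℚ (a ℕ.+ b))             ∎)
    where
    open ℚᵘ.≃-Reasoning
    cross : ∀ A B → (A ℤ.* + 1 ℤ.+ B ℤ.* + 1) ℤ.* + 1 ≡ (A ℤ.+ B) ℤ.* + 1
    cross = solve-∀

  sum1to-nℚ : ∀ n f → sum1to n (λ k → nℚ (f k)) ≡ nℚ (Σ n f)
  sum1to-nℚ zero    f = refl
  sum1to-nℚ (suc n) f = trans (cong (ℚ._+ nℚ (f (suc n))) (sum1to-nℚ n f)) (nℚ-+ (Σ n f) (f (suc n)))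

  halve : ∀ s₁ s₂ c → s₁ ℕ.+ 2 ℕ.* s₂ ℕ.+ 2 ≡ 2 ℕ.* c → ½ ℚ.* nℚ s₁ ℚ.+ nℚ s₂ ≡ nℚ c ℚ.- nℚ 1
  halve s₁ s₂ c h = toℚᵘ-injective (begin
    toℚᵘ (½ ℚ.* nℚ s₁ ℚ.+ nℚ s₂)          ≈⟨ toℚᵘ-homo-+ (½ ℚ.* nℚ s₁) (nℚ s₂) ⟩
    toℚᵘ (½ ℚ.* nℚ s₁) ℚᵘ.+ toℚᵘ (nℚ s₂)  ≈⟨ ℚᵘ.+-cong (toℚᵘ-homo-* ½ (nℚ s₁)) (toℚᵘ-int (+ s₂)) ⟩
    toℚᵘ ½ ℚᵘ.* toℚᵘ (nℚ s₁) ℚᵘ.+ ι (+ s₂) ≈⟨ ℚᵘ.+-congˡ (ι (+ s₂)) (ℚᵘ.*-congˡ {toℚᵘ ½} (toℚᵘ-int (+ s₁))) ⟩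
    toℚᵘ ½ ℚᵘ.* ι (+ s₁) ℚᵘ.+ ι (+ s₂)    ≈⟨ *≡* (trans (lhs (+ s₁) (+ s₂)) (trans (cong (ℤ._- + 2) hℤ) (rhs (+ c)))) ⟩
    ι (+ c) ℚᵘ.- ι (+ 1)                  ≈⟨ toℚᵘ-nℚ-minus c 1 ⟨
    toℚᵘ (nℚ c ℚ.- nℚ 1)                  ∎)
    where
    open ℚᵘ.≃-Reasoning
    hℤ : + s₁ ℤ.+ + 2 ℤ.* + s₂ ℤ.+ + 2 ≡ + 2 ℤ.* + c
    hℤ = trans (sym (trans (ℤ.pos-+ (s₁ ℕ.+ 2 ℕ.* s₂) 2) (cong (ℤ._+ + 2) (trans (ℤ.pos-+ s₁ (2 ℕ.* s₂))
                  (cong (λ w → + s₁ ℤ.+ w) (ℤ.pos-* 2 s₂))))))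
               (trans (cong +_ h) (ℤ.pos-* 2 c))
    lhs : ∀ A B → ((+ 1 ℤ.* A) ℤ.* + 1 ℤ.+ B ℤ.* + 2) ℤ.* + 1 ≡ (A ℤ.+ + 2 ℤ.* B ℤ.+ + 2) ℤ.- + 2
    lhs = solve-∀
    rhs : ∀ C → + 2 ℤ.* C ℤ.- + 2 ≡ (C ℤ.* + 1 ℤ.+ (ℤ.- + 1) ℤ.* + 1) ℤ.* + 2
    rhs = solve-∀

  divide : ∀ c t M .{{_ : ℕ.NonZero M}} z → (+ c ℤ.- + 1) ℤ.- + t ≡ z ℤ.* + M →
           (nℚ c ℚ.- nℚ 1 ℚ.- nℚ t) ℚ.* (+ 1 ℚ./ M) ≡ z ℚ./ 1
  divide c t (suc M) z h = toℚᵘ-injective (begin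
    toℚᵘ ((nℚ c ℚ.- nℚ 1 ℚ.- nℚ t) ℚ.* (+ 1 ℚ./ suc M))         ≈⟨ toℚᵘ-homo-* (nℚ c ℚ.- nℚ 1 ℚ.- nℚ t) _ ⟩
    toℚᵘ (nℚ c ℚ.- nℚ 1 ℚ.- nℚ t) ℚᵘ.* toℚᵘ (+ 1 ℚ./ suc M)
      ≈⟨ ℚᵘ.*-cong (ℚᵘ.≃-trans (toℚᵘ-minus (nℚ c ℚ.- nℚ 1) (nℚ t))
                               (ℚᵘ.+-cong (toℚᵘ-nℚ-minus c 1) (ℚᵘ.-‿cong (toℚᵘ-int (+ t)))))
                   (toℚᵘ-fromℚᵘ (mkℚᵘ (+ 1) M)) ⟩
    (ι (+ c) ℚᵘ.- ι (+ 1) ℚᵘ.- ι (+ t)) ℚᵘ.* mkℚᵘ (+ 1) M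
      ≈⟨ *≡* (trans (lhs (+ c) (+ t)) (trans h (cong (λ m → z ℤ.* + suc m) (sym (ℕ.+-identityʳ M))))) ⟩
    ι z                                                        ≈⟨ toℚᵘ-int z ⟨
    toℚᵘ (z ℚ./ 1)                                             ∎)
    where
    open ℚᵘ.≃-Reasoning
    lhs : ∀ C T → ((((C ℤ.* + 1 ℤ.+ (ℤ.- + 1) ℤ.* + 1) ℤ.* + 1 ℤ.+ (ℤ.- T) ℤ.* + 1) ℤ.* + 1) ℤ.* + 1) ≡ (C ℤ.- + 1) ℤ.- T
    lhs = solve-∀

  ↧ₙ-int : ∀ z → ↧ₙ (z ℚ./ 1) ≡ 1
  ↧ₙ-int z = ℕ.m*n≡1⇒m≡1 (↧ₙ (z ℚ./ 1)) _ (trans (sym (ℤ.abs-* (↧ (z ℚ./ 1)) (gcd z (+ 1)))) (cong ℤ.∣_∣ (↧-/ z 1)))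

open import Defs
open import Data.Nat using (ℕ; _∸_; _^_; _≥_) renaming (_*_ to _*ℕ_; _+_ to _+ℕ_)
open import Data.Nat.Combinatorics using (_C_)
open import Data.Nat.Primality using (Prime; prime⇒nonZero)
open import Data.Rational using (½; _+_; _-_; _*_)
open import Data.Product using (_×_)
open import Relation.Binary.PropositionalEquality using (_≡_)

import Data.Nat.Properties as ℕ
import Data.Nat.Divisibility as ℕ
import Data.Integer as ℤ
import Data.Integer.Properties as ℤ
open import Data.Integer.Divisibility.Signed using (divides)
open import Data.Integer.Tactic.RingSolver using (solve-∀)
open import Relation.Binary.PropositionalEquality using (sym; trans; cong; cong₂; subst)
open import Data.Product using (_,_)
open IntCongruence using (_≡_⟨mod_⟩; mod-intro)
open CentralBinomial using (B)
open RationalTransfer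
open CentralBinomialSum using (S₁; S₂; B-sum)

sum-identity : ∀ q → 1 ℕ.≤ q →
  ½ * sum1to (q ∸ 1) (λ k → nℚ ((2 *ℕ k) C k)) + sum1to (q ∸ 1) (λ k → nℚ ((2 *ℕ k) C (k +ℕ 1)))
  ≡ nℚ (B q) - nℚ 1
sum-identity (ℕ.suc N) _ =
  trans (cong₂ (λ x y → ½ * x + y) (sum1to-nℚ N (λ k → (2 *ℕ k) C k)) (sum1to-nℚ N (λ k → (2 *ℕ k) C (k +ℕ 1))))
        (halve (S₁ N) (S₂ N) (B (ℕ.suc N)) (B-sum N))

int-mod⇒ℚ-mod : ∀ {p} (pp : Prime p) k c t → ℤ.+ c ≡ ℤ.+ (1 +ℕ t) ⟨mod ℤ.+ (p ^ k) ⟩ →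
                _≡_[mod_^_] (nℚ c - nℚ 1) (nℚ t) p {{prime⇒nonZero pp}} k
int-mod⇒ℚ-mod {p} pp k c t (mod-intro (divides z c-[1+t]≡zp^k)) p∣den =
  Arithmetic.prime∤1 pp (subst (p ℕ.∣_) (trans (cong Data.Rational.↧ₙ_ scaled≡z) (↧ₙ-int z)) p∣den)
  where
  instance _ = ℕ.m^n≢0 p k {{prime⇒nonZero pp}}
  regroup : ∀ C T → C ℤ.- (ℤ.+ 1 ℤ.+ T) ≡ (C ℤ.- ℤ.+ 1) ℤ.- T
  regroup = solve-∀
  scaled≡z : (nℚ c - nℚ 1 - nℚ t) * (ℤ.+ 1 Data.Rational./ p ^ k) ≡ z Data.Rational./ 1
  scaled≡z = divide c t (p ^ k) z
    (trans (sym (regroup (ℤ.+ c) (ℤ.+ t))) (trans (cong (λ w → ℤ.+ c ℤ.- w) (sym (ℤ.pos-+ 1 t))) c-[1+t]≡zp^k))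

lemma2p2 : (p a : ℕ) → (pp : Prime p) → a ≥ 1 →
    let q = p ^ a
        lhs = ½ * sum1to (q ∸ 1) (λ k → nℚ ((2 *ℕ k) C k))
              + sum1to (q ∸ 1) (λ k → nℚ ((2 *ℕ k) C (k +ℕ 1)))
        rhs = nℚ ((2 *ℕ q ∸ 1) C (q ∸ 1)) - nℚ 1
    in (lhs ≡ rhs)
       × (_≡_[mod_^_] rhs (nℚ (p *ℕ iv p 2 +ℕ p ^ 2 *ℕ iv p 3)) p {{prime⇒nonZero pp}} 3)
lemma2p2 p a pp a≥1 =
    sum-identity (p ^ a) (ℕ.m^n>0 p {{prime⇒nonZero pp}} a)
  , int-mod⇒ℚ-mod pp 3 (B (p ^ a)) _ (Lifting.B-mod-p³ pp a a≥1)
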